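{- Let $N,h\in\mathbb{N}$, let $\mathcal{T}$ be an $(N,h)$-regular rooted tree, let $\mathcal{S}\subset\mathcal{T}$ be a subtree, and let $1\le m\le N$ be an integer. Suppose that for every $(m,h)$-regular subtree $\mathcal{R}$ of $\mathcal{T}$ one has $\mathcal{S}_h\cap\mathcal{R}_h\neq\emptyset$. Then $\mathcal{S}$ has an $(N-m+1,h)$-regular subtree.
   Context: A rooted tree is a connected graph without cycles with a distinguished vertex $\tau_0$ (the root); it is identified with its vertex set. The height of a vertex is the length of the unique path from it to the root; for a rooted tree $\mathcal{T}$, $\mathcal{T}_n$ denotes the set of vertices of height $n$. A vertex $\tau$ is a successor of $\tau'$ if $\tau'$ lies on the path from $\tau$ to the root and the height of $\tau$ is one more than that of $\tau'$. A subtree of $\mathcal{T}$ is a subset of vertices forming a rooted tree with the same root $\tau_0$ (a subset containing $\tau_0$ and closed under taking predecessors); for a subtree $\mathcal{S}$, $\mathcal{S}_n=\mathcal{S}\cap\mathcal{T}_n$. A finite rooted tree is $(N,h)$-regular if it has no vertex of height $h+1$ and every vertex of height less than $h$ has exactly $N$ successors. -}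

module Defs where

open import Data.Nat using (ℕ; _≤_; _<_)
open import Data.Fin using (Fin)
open import Data.Bool using (Bool; true)
open import Data.List using (List; []; _∷_; length; filterᵇ; allFin)
open import Data.Product using (_×_)
open import Relation.Binary.PropositionalEquality using (_≡_)

-- Canonical (N,h)-regular rooted tree 𝒯(N,h): vertices are words
-- v : List (Fin N) with length v ≤ h; the root is [], the height of v is
-- length v, and the successors of v are the words x ∷ v (x : Fin N).
-- Every (N,h)-regular rooted tree is isomorphic to this one.

VSet : ℕ → Set
VSet N = List (Fin N) → Bool

_∈ᵥ_ : {N : ℕ} → List (Fin N) → VSet N → Set
v ∈ᵥ A = A v ≡ true

IsSubtree : (N h : ℕ) → VSet N → Set
IsSubtree N h A =
  ([] ∈ᵥ A)
  × (∀ (x : Fin N) (v : List (Fin N)) → (x ∷ v) ∈ᵥ A → v ∈ᵥ A)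
  × (∀ (v : List (Fin N)) → v ∈ᵥ A → length v ≤ h)

_⊆ᵥ_ : {N : ℕ} → VSet N → VSet N → Set
A ⊆ᵥ B = ∀ v → v ∈ᵥ A → v ∈ᵥ B

succCount : {N : ℕ} → VSet N → List (Fin N) → ℕ
succCount {N} A v = length (filterᵇ (λ x → A (x ∷ v)) (allFin N))

IsRegularSubtree : (N h k : ℕ) → VSet N → Set
IsRegularSubtree N h k A =
  IsSubtree N h A
  × (∀ (v : List (Fin N)) → v ∈ᵥ A → length v < h → succCount A v ≡ k)

module Submission where

-- Proof idea: classify vertices from the leaves upwards.

open import Defs
open import Data.Nat using (ℕ; _≤_; _+_; _∸_)
open import Data.Fin using (Fin)
open import Data.List using (List; length)
open import Data.Product using (_×_; Σ; ∃)
open import Relation.Binary.PropositionalEquality using (_≡_)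

open import Data.Nat using (zero; suc; _<_; _<ᵇ_; _≤ᵇ_; z≤n; s≤s)
open import Data.Nat.Properties
  using (+-suc; +-∸-assoc; m+n∸m≡n; m∸[m∸n]≡n; ∸-monoʳ-≤; n∸n≡0; m≤n+m;
         m<1+n⇒m≤n; +-comm; ≰⇒>; <ᵇ⇒<; <⇒<ᵇ; ≤ᵇ⇒≤; ≤⇒≤ᵇ)
open import Data.Fin using (zero; suc)
open import Data.List using ([]; _∷_; filterᵇ; tabulate)
open import Data.Bool using (Bool; true; false; _∧_; not; if_then_else_; T)
open import Data.Bool.Properties using (T-≡; ∧-conicalˡ; ∧-conicalʳ; not-involutive)
open import Data.Product using (_,_)
open import Function using (_∘_; id)
open import Function.Bundles using (module Equivalence)
open import Relation.Binary.PropositionalEquality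
  using (refl; sym; trans; cong; subst; module ≡-Reasoning)

open Equivalence using (to; from)

false-contra : ∀ {a b : Bool} → (a ≡ true → b ≡ true) → b ≡ false → a ≡ false
false-contra {false} _ _ = refl
false-contra {true}  a⇒b b≡false with trans (sym (a⇒b refl)) b≡false
... | ()

not-true : ∀ {b : Bool} → not b ≡ true → b ≡ false
not-true {b} nb = trans (sym (not-involutive b)) (cong not nb)

count : ∀ {n} → (Fin n → Bool) → ℕ
count {zero}  p = 0
count {suc n} p = (if p zero then 1 else 0) + count (p ∘ suc)

length-filterᵇ-tabulate : ∀ {n} {A : Set} (q : A → Bool) (f : Fin n → A) →
                          length (filterᵇ q (tabulate f)) ≡ count (q ∘ f)
length-filterᵇ-tabulate {zero}  q f = refl
length-filterᵇ-tabulate {suc n} q f with q (f zero)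
... | true  = cong suc (length-filterᵇ-tabulate q (f ∘ suc))
... | false = length-filterᵇ-tabulate q (f ∘ suc)

count-cong : ∀ {n} {p q : Fin n → Bool} → (∀ x → p x ≡ q x) → count p ≡ count q
count-cong {zero}        p≗q = refl
count-cong {suc n} {p} {q} p≗q rewrite p≗q zero = cong (_ +_) (count-cong (p≗q ∘ suc))

count-none : ∀ {n} {p : Fin n → Bool} → (∀ x → p x ≡ false) → count p ≡ 0
count-none {zero}        none = refl
count-none {suc n} {p} none rewrite none zero = count-none (none ∘ suc)

count-complement : ∀ {n} (p : Fin n → Bool) → count p + count (not ∘ p) ≡ n
count-complement {zero}  p = refl
count-complement {suc n} p with p zero
... | true  = cong suc (count-complement (p ∘ suc))
... | false = trans (+-suc _ _) (cong suc (count-complement (p ∘ suc)))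

count-complement-≥ : ∀ {n m} (p : Fin n → Bool) → m ≤ n → count p ≤ n ∸ m →
                     m ≤ count (not ∘ p)
count-complement-≥ {n} {m} p m≤n few =
  subst (_≤ count (not ∘ p)) (m∸[m∸n]≡n m≤n)
        (subst (n ∸ (n ∸ m) ≤_) complement≡ (∸-monoʳ-≤ n few))
  where
  complement≡ : n ∸ count p ≡ count (not ∘ p)
  complement≡ = trans (cong (_∸ count p) (sym (count-complement p)))
                      (m+n∸m≡n (count p) _)

-- select p k keeps the first k elements satisfying p (all of them if there
-- are fewer than k).
select : ∀ {n} → (Fin n → Bool) → ℕ → Fin n → Bool
select p k zero    = p zero ∧ (0 <ᵇ k)
select p k (suc x) = select (p ∘ suc) (if p zero then k ∸ 1 else k) x

select-⊆ : ∀ {n} (p : Fin n → Bool) k x → select p k x ≡ true → p x ≡ true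
select-⊆ p k zero    chosen = ∧-conicalˡ _ _ chosen
select-⊆ p k (suc x) chosen = select-⊆ (p ∘ suc) _ x chosen

count-select : ∀ {n} (p : Fin n → Bool) k → k ≤ count p → count (select p k) ≡ k
count-select {zero}  p .0 z≤n = refl
count-select {suc n} p k k≤ with p zero
count-select {suc n} p zero    k≤        | true  = count-select (p ∘ suc) 0 z≤n
count-select {suc n} p (suc k) (s≤s k≤) | true  = cong suc (count-select (p ∘ suc) k k≤)
...                                      | false = count-select (p ∘ suc) k k≤

successorsIn : ∀ {N} → VSet N → List (Fin N) → Fin N → Bool
successorsIn A v x = A (x ∷ v)

succCount≡count : ∀ {N} (A : VSet N) v → succCount A v ≡ count (successorsIn A v)
succCount≡count A v = length-filterᵇ-tabulate (successorsIn A v) id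

levels-below : ∀ {ℓ h} → ℓ < h → h ∸ ℓ ≡ suc (h ∸ suc ℓ)
levels-below = +-∸-assoc 1

module Pruning (N h k : ℕ) (Q : VSet N) where

  pruned : VSet N
  pruned []      = true
  pruned (x ∷ v) = pruned v ∧ ((length v <ᵇ h) ∧ select (successorsIn Q v) k x)

  pruned-height : ∀ v → v ∈ᵥ pruned → length v ≤ h
  pruned-height []      _    = z≤n
  pruned-height (x ∷ v) kept =
    <ᵇ⇒< _ _ (from T-≡ (∧-conicalˡ _ _ (∧-conicalʳ (pruned v) _ kept)))

  pruned-subtree : IsSubtree N h pruned
  pruned-subtree = refl , (λ x v → ∧-conicalˡ _ _) , pruned-height

  pruned-⊆ : [] ∈ᵥ Q → pruned ⊆ᵥ Q
  pruned-⊆ root []      _    = root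
  pruned-⊆ root (x ∷ v) kept =
    select-⊆ (successorsIn Q v) k x (∧-conicalʳ _ _ (∧-conicalʳ (pruned v) _ kept))

  pruned-successors : ∀ v → v ∈ᵥ pruned → length v < h →
                      ∀ x → successorsIn pruned v x ≡ select (successorsIn Q v) k x
  pruned-successors v kept ℓ<h x rewrite kept | to T-≡ (<⇒<ᵇ ℓ<h) = refl

  pruned-regular : [] ∈ᵥ Q → (∀ v → v ∈ᵥ Q → length v < h → k ≤ succCount Q v) →
                   ∀ v → v ∈ᵥ pruned → length v < h → succCount pruned v ≡ k
  pruned-regular root enough v kept ℓ<h = begin
    succCount pruned v                   ≡⟨ succCount≡count pruned v ⟩
    count (successorsIn pruned v)        ≡⟨ count-cong (pruned-successors v kept ℓ<h) ⟩
    count (select (successorsIn Q v) k)  ≡⟨ count-select (successorsIn Q v) k k≤ ⟩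
    k                                    ∎
    where
    open ≡-Reasoning
    k≤ : k ≤ count (successorsIn Q v)
    k≤ = subst (k ≤_) (succCount≡count Q v) (enough v (pruned-⊆ root v kept) ℓ<h)

regularSubtree : (N h k : ℕ) (Q : VSet N) → [] ∈ᵥ Q →
                 (∀ v → v ∈ᵥ Q → length v < h → k ≤ succCount Q v) →
                 Σ (VSet N) λ R → IsRegularSubtree N h k R × R ⊆ᵥ Q
regularSubtree N h k Q root enough =
  pruned , (pruned-subtree , pruned-regular root enough) , pruned-⊆ root
  where open Pruning N h k Q

module Good (N h k : ℕ) (S : VSet N) where

  goodAt : ℕ → VSet N
  goodAt zero    v = S v
  goodAt (suc d) v = S v ∧ (k ≤ᵇ count (successorsIn (goodAt d) v))

  good : VSet N
  good v = goodAt (h ∸ length v) v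

  good-⊆ : good ⊆ᵥ S
  good-⊆ v = goodAt-⊆ (h ∸ length v)
    where
    goodAt-⊆ : ∀ d → goodAt d v ≡ true → S v ≡ true
    goodAt-⊆ zero    g = g
    goodAt-⊆ (suc d) g = ∧-conicalˡ _ _ g

  good-leaf : ∀ v → length v ≡ h → good v ≡ S v
  good-leaf v ℓ≡h rewrite ℓ≡h | n∸n≡0 h = refl

  good-inner : ∀ v → length v < h → good v ≡ S v ∧ (k ≤ᵇ count (successorsIn good v))
  good-inner v ℓ<h rewrite levels-below ℓ<h = refl

  goodRoot⇒regularSubtree : [] ∈ᵥ good →
                            Σ (VSet N) λ R → IsRegularSubtree N h k R × R ⊆ᵥ S
  goodRoot⇒regularSubtree root =
    let R , regular , R⊆good = regularSubtree N h k good root enough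
    in  R , regular , (λ v → good-⊆ v ∘ R⊆good v)
    where
    enough : ∀ v → v ∈ᵥ good → length v < h → k ≤ succCount good v
    enough v g ℓ<h = subst (k ≤_) (sym (succCount≡count good v))
      (≤ᵇ⇒≤ _ _ (from T-≡ (∧-conicalʳ (S v) _ (trans (sym (good-inner v ℓ<h)) g))))

  -- A bad vertex of height < h has fewer than k good successors: either it
  -- lies outside S, and then so do all its successors, or the count fails.
  bad⇒fewGood : IsSubtree N h S → 0 < k → ∀ v → good v ≡ false → length v < h →
                count (successorsIn good v) < k
  bad⇒fewGood (_ , S-closed , _) 0<k v bad ℓ<h with S v in v∈S
  ... | false = subst (_< k) (sym (count-none outside)) 0<k
    where
    outside : ∀ x → good (x ∷ v) ≡ false
    outside x = false-contra (S-closed x v ∘ good-⊆ (x ∷ v)) v∈S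
  ... | true = ≰⇒> λ k≤ → subst T countFails (≤⇒≤ᵇ k≤)
    where
    enoughGood : Bool
    enoughGood = k ≤ᵇ count (successorsIn good v)
    countFails : enoughGood ≡ false
    countFails = begin
      enoughGood         ≡⟨ cong (_∧ enoughGood) v∈S ⟨
      S v ∧ enoughGood   ≡⟨ good-inner v ℓ<h ⟨
      good v             ≡⟨ bad ⟩
      false              ∎
      where open ≡-Reasoning

-- Bad root, with k = N - m + 1: every bad vertex of height < h has at most
-- N - m good, hence at least m bad successors, so the bad vertices contain
-- an (m,h)-regular subtree; its vertices of height h are bad leaves, i.e.
-- outside S.
badRoot⇒avoidingSubtree :
  (N h m : ℕ) → m ≤ N → (S : VSet N) → IsSubtree N h S →
  Good.good N h (N ∸ m + 1) S [] ≡ false →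
  Σ (VSet N) λ R → IsRegularSubtree N h m R × (∀ v → length v ≡ h → v ∈ᵥ R → S v ≡ false)
badRoot⇒avoidingSubtree N h m m≤N S S-subtree root =
  let R , regular , R⊆bad = regularSubtree N h m bad (cong not root) manyBad
  in  R , regular , λ v ℓ≡h v∈R → trans (sym (good-leaf v ℓ≡h)) (not-true (R⊆bad v v∈R))
  where
  open Good N h (N ∸ m + 1) S

  bad : VSet N
  bad = not ∘ good

  manyBad : ∀ v → v ∈ᵥ bad → length v < h → m ≤ succCount bad v
  manyBad v b ℓ<h = subst (m ≤_) (sym (succCount≡count bad v))
    (count-complement-≥ (successorsIn good v) m≤N (m<1+n⇒m≤n fewGood))
    where
    fewGood : count (successorsIn good v) < suc (N ∸ m)
    fewGood = subst (count (successorsIn good v) <_) (+-comm (N ∸ m) 1)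
                (bad⇒fewGood S-subtree (m≤n+m 1 (N ∸ m)) v (not-true b) ℓ<h)

lemma2p2 : (N h m : ℕ) → 1 ≤ m → m ≤ N → (S : VSet N) → IsSubtree N h S
    → (∀ (R : VSet N) → IsRegularSubtree N h m R
         → ∃ λ (v : List (Fin N)) → length v ≡ h × v ∈ᵥ S × v ∈ᵥ R)
    → Σ (VSet N) λ R → IsRegularSubtree N h (N ∸ m + 1) R × R ⊆ᵥ S
lemma2p2 N h m _ m≤N S S-subtree meets with Good.good N h (N ∸ m + 1) S [] in root
... | true  = Good.goodRoot⇒regularSubtree N h (N ∸ m + 1) S root
... | false with badRoot⇒avoidingSubtree N h m m≤N S S-subtree root
...   | R , regular , avoidsS with meets R regular
...     | v , ℓ≡h , v∈S , v∈R with trans (sym v∈S) (avoidsS v ℓ≡h v∈R)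
...       | ()
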